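{- For every closed recHML formula $\psi$, $[\![\psi]\!]_F\cap\mathit{Act}^\omega=[\![\psi]\!]_L$.
   Context: Fix a finite set $\mathit{Act}$ of actions. recHML: $\psi::=\mathrm{tt}\mid\mathrm{ff}\mid\psi\vee\psi\mid\psi\wedge\psi\mid\langle A\rangle\psi\mid[A]\psi\mid\min X.\psi\mid\max X.\psi\mid X$, $A\subseteq\mathit{Act}$, guarded. For a domain $D$ (either $\mathit{Act}^\omega$, giving the linear-time semantics $[\![\cdot]\!]_L$, or $\mathit{Act}^*\cup\mathit{Act}^\omega$, giving the finfinite semantics $[\![\cdot]\!]_F$), with valuations $\sigma$ from variables to subsets of $D$: $[\![\mathrm{tt}]\!]=D$, $[\![\mathrm{ff}]\!]=\emptyset$, $\vee,\wedge$ union/intersection, $[\![\langle A\rangle\psi]\!]=\{ag\mid a\in A,g\in[\![\psi]\!]\}$, $[\![[A]\psi]\!]=\{g\in D\mid\forall a\in A,\forall g'.\ g=ag'\Rightarrow g'\in[\![\psi]\!]\}$, $[\![\min X.\psi,\sigma]\!]=\bigcap\{S\subseteq D\mid[\![\psi,\sigma[X\mapsto S]]\!]\subseteq S\}$, $[\![\max X.\psi,\sigma]\!]=\bigcup\{S\subseteq D\mid S\subseteq[\![\psi,\sigma[X\mapsto S]]\!]\}$, $[\![X,\sigma]\!]=\sigma(X)$. -}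

module Defs where

open import Level using (Level; Lift; lift) renaming (zero to lzero; suc to lsuc)
open import Data.Nat using (ℕ; zero; suc)
open import Data.Fin using (Fin; zero; suc)
open import Data.Fin.Subset using (Subset; _∈_)
open import Data.List using (List; []; _∷_)
open import Data.Maybe using (Maybe; just; nothing)
open import Data.Product using (Σ; _×_; _,_; ∃)
open import Data.Sum using (_⊎_; inj₁; inj₂)
open import Data.Unit using (⊤)
open import Data.Empty using (⊥)
open import Relation.Binary.PropositionalEquality using (_≡_; _≢_)

-- The action set Act is Fin k (an arbitrary finite set).
-- recHML formulas with de Bruijn variables: Formula n has n free variables.
-- A ⊆ Act is a Subset k.

data Formula (k : ℕ) (n : ℕ) : Set where
  tt ff   : Formula k n
  _∨'_ _∧'_ : Formula k n → Formula k n → Formula k n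
  ⟨_⟩_ [_]_ : Subset k → Formula k n → Formula k n
  minF maxF : Formula k (suc n) → Formula k n
  var     : Fin n → Formula k n

GuardedIn : ∀ {k n} → Fin n → Formula k n → Set
GuardedIn i tt = ⊤
GuardedIn i ff = ⊤
GuardedIn i (φ ∨' ψ) = GuardedIn i φ × GuardedIn i ψ
GuardedIn i (φ ∧' ψ) = GuardedIn i φ × GuardedIn i ψ
GuardedIn i (⟨ A ⟩ ψ) = ⊤
GuardedIn i ([ A ] ψ) = ⊤
GuardedIn i (minF ψ) = GuardedIn (suc i) ψ
GuardedIn i (maxF ψ) = GuardedIn (suc i) ψ
GuardedIn i (var j) = j ≢ i

Guarded : ∀ {k n} → Formula k n → Set
Guarded tt = ⊤
Guarded ff = ⊤
Guarded (φ ∨' ψ) = Guarded φ × Guarded ψ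
Guarded (φ ∧' ψ) = Guarded φ × Guarded ψ
Guarded (⟨ A ⟩ ψ) = Guarded ψ
Guarded ([ A ] ψ) = Guarded ψ
Guarded (minF ψ) = GuardedIn zero ψ × Guarded ψ
Guarded (maxF ψ) = GuardedIn zero ψ × Guarded ψ
Guarded (var j) = ⊤

-- A trace domain: a carrier with its decomposition g = a g'
-- (uncons g ≡ just (a , g') means g = a g'; nothing means g is empty).

record Domain (k : ℕ) : Set₁ where
  field
    Carrier : Set
    uncons  : Carrier → Maybe (Fin k × Carrier)

Pred : Set → Set₁
Pred D = D → Set

module Semantics {k : ℕ} (𝒟 : Domain k) where
  open Domain 𝒟

  Val : ℕ → Set₁
  Val n = Fin n → Pred Carrier

  extend : ∀ {n} → Pred Carrier → Val n → Val (suc n)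
  extend S σ zero = S
  extend S σ (suc i) = σ i

  -- Knaster–Tarski semantics; fixpoints quantify over all subsets S.
  ⟦_⟧ : ∀ {n} → Formula k n → Val n → Carrier → Set₁
  ⟦ tt ⟧ σ g = Lift _ ⊤
  ⟦ ff ⟧ σ g = Lift _ ⊥
  ⟦ φ ∨' ψ ⟧ σ g = ⟦ φ ⟧ σ g ⊎ ⟦ ψ ⟧ σ g
  ⟦ φ ∧' ψ ⟧ σ g = ⟦ φ ⟧ σ g × ⟦ ψ ⟧ σ g
  ⟦ ⟨ A ⟩ ψ ⟧ σ g = Σ (Fin k) λ a → Σ Carrier λ g' →
                     (uncons g ≡ just (a , g')) × (a ∈ A) × ⟦ ψ ⟧ σ g'
  ⟦ [ A ] ψ ⟧ σ g = ∀ (a : Fin k) (g' : Carrier) →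
                     a ∈ A → uncons g ≡ just (a , g') → ⟦ ψ ⟧ σ g'
  ⟦ minF ψ ⟧ σ g = ∀ (S : Pred Carrier) →
                     (∀ h → ⟦ ψ ⟧ (extend S σ) h → S h) → S g
  ⟦ maxF ψ ⟧ σ g = Σ (Pred Carrier) λ S →
                     (∀ h → S h → ⟦ ψ ⟧ (extend S σ) h) × S g
  ⟦ var i ⟧ σ g = Lift _ (σ i g)

  emptyVal : Val 0
  emptyVal ()

-- Infinite traces Act^ω as functions ℕ → Act.
Stream : ℕ → Set
Stream k = ℕ → Fin k

-- Finfinite traces Act^* ∪ Act^ω.
FTrace : ℕ → Set
FTrace k = List (Fin k) ⊎ Stream k

LDomain : (k : ℕ) → Domain k
LDomain k = record { Carrier = Stream k ; uncons = λ f → just (f zero , λ m → f (suc m)) }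

unconsF : ∀ {k} → FTrace k → Maybe (Fin k × FTrace k)
unconsF (inj₁ []) = nothing
unconsF (inj₁ (a ∷ l)) = just (a , inj₁ l)
unconsF (inj₂ f) = just (f zero , inj₂ (λ m → f (suc m)))

FDomain : (k : ℕ) → Domain k
FDomain k = record { Carrier = FTrace k ; uncons = unconsF }

⟦_⟧L : ∀ {k} → Formula k 0 → Stream k → Set₁
⟦ ψ ⟧L = Semantics.⟦_⟧ (LDomain _) ψ (Semantics.emptyVal (LDomain _))

⟦_⟧F : ∀ {k} → Formula k 0 → FTrace k → Set₁
⟦ ψ ⟧F = Semantics.⟦_⟧ (FDomain _) ψ (Semantics.emptyVal (FDomain _))

-- Act^ω is closed under taking tails, so the modalities never move an infinite trace to a
-- finite one, and the finite traces in a candidate fixpoint S are irrelevant to its infinite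
-- part: a least fixpoint may add all finite traces and a greatest one may drop them.
-- Hence, by induction on formulas, the finfinite and linear-time semantics agree on Act^ω
-- under any two valuations that agree there.
module Submission where

open import Defs
open import Data.Nat using (ℕ)
open import Data.Fin using (zero; suc)
open import Data.Sum using (inj₁; inj₂; [_,_])
open import Data.Sum.Function.Propositional using (_⊎-⇔_)
open import Data.Product using (_×_; _,_)
open import Data.Product.Function.NonDependent.Propositional using (_×-⇔_)
open import Data.Unit using (⊤)
open import Data.Empty using (⊥)
open import Function using (_∘_; const)
open import Function.Bundles using (_⇔_; mk⇔; Equivalence)
open import Function.Properties.Equivalence using () renaming (refl to ⇔-refl)
open import Level using (lift; lower)
open import Relation.Binary.PropositionalEquality using (refl)

open Equivalence using (to; from)

module _ {k : ℕ} where
  private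
    module L = Semantics (LDomain k)
    module F = Semantics (FDomain k)

  _restrictsTo_ : ∀ {ℓ} → (FTrace k → Set ℓ) → (Stream k → Set ℓ) → Set ℓ
  S restrictsTo T = ∀ g → S (inj₂ g) ⇔ T g

  _agreeOnStreams_ : ∀ {n} → F.Val n → L.Val n → Set
  σF agreeOnStreams σL = ∀ i → σF i restrictsTo σL i

  withFinite withoutFinite : Pred (Stream k) → Pred (FTrace k)
  withFinite T = [ const ⊤ , T ]
  withoutFinite T = [ const ⊥ , T ]

  extend-agreeOnStreams : ∀ {n} {σF : F.Val n} {σL : L.Val n} → σF agreeOnStreams σL →
    (S : Pred (FTrace k)) → F.extend S σF agreeOnStreams L.extend (S ∘ inj₂) σL
  extend-agreeOnStreams σF≈σL S zero g = ⇔-refl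
  extend-agreeOnStreams σF≈σL S (suc i) = σF≈σL i

  ⟦⟧-agreeOnStreams : ∀ {n} (ψ : Formula k n) {σF : F.Val n} {σL : L.Val n} →
    σF agreeOnStreams σL → F.⟦ ψ ⟧ σF restrictsTo L.⟦ ψ ⟧ σL
  ⟦⟧-agreeOnStreams tt σF≈σL f = ⇔-refl
  ⟦⟧-agreeOnStreams ff σF≈σL f = ⇔-refl
  ⟦⟧-agreeOnStreams (φ ∨' ψ) σF≈σL f =
    ⟦⟧-agreeOnStreams φ σF≈σL f ⊎-⇔ ⟦⟧-agreeOnStreams ψ σF≈σL f
  ⟦⟧-agreeOnStreams (φ ∧' ψ) σF≈σL f =
    ⟦⟧-agreeOnStreams φ σF≈σL f ×-⇔ ⟦⟧-agreeOnStreams ψ σF≈σL f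
  ⟦⟧-agreeOnStreams (⟨ A ⟩ ψ) σF≈σL f = mk⇔
    (λ { (a , _ , refl , a∈A , ψg) → a , _ , refl , a∈A , to (⟦⟧-agreeOnStreams ψ σF≈σL _) ψg })
    (λ { (a , _ , refl , a∈A , ψg) → a , _ , refl , a∈A , from (⟦⟧-agreeOnStreams ψ σF≈σL _) ψg })
  ⟦⟧-agreeOnStreams ([ A ] ψ) σF≈σL f = mk⇔
    (λ □ψ a _ a∈A → λ { refl → to (⟦⟧-agreeOnStreams ψ σF≈σL _) (□ψ a _ a∈A refl) })
    (λ □ψ a _ a∈A → λ { refl → from (⟦⟧-agreeOnStreams ψ σF≈σL _) (□ψ a _ a∈A refl) })
  ⟦⟧-agreeOnStreams (minF ψ) {σF} {σL} σF≈σL f = mk⇔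
    (λ μψ T T-closed → μψ (withFinite T) λ
      { (inj₁ _) _ → _
      ; (inj₂ g) ψg → T-closed g (to (body (withFinite T) g) ψg) })
    (λ μψ S S-closed → μψ (S ∘ inj₂) λ g ψg →
      S-closed (inj₂ g) (from (body S g) ψg))
    where
    body : (S : Pred (FTrace k)) → F.⟦ ψ ⟧ (F.extend S σF) restrictsTo L.⟦ ψ ⟧ (L.extend (S ∘ inj₂) σL)
    body S = ⟦⟧-agreeOnStreams ψ (extend-agreeOnStreams σF≈σL S)
  ⟦⟧-agreeOnStreams (maxF ψ) {σF} {σL} σF≈σL f = mk⇔
    (λ { (S , S-consistent , Sf) →
         S ∘ inj₂ , (λ g Sg → to (body S g) (S-consistent (inj₂ g) Sg)) , Sf })
    (λ { (T , T-consistent , Tf) → withoutFinite T , (λ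
         { (inj₁ _) ()
         ; (inj₂ g) Tg → from (body (withoutFinite T) g) (T-consistent g Tg) }) , Tf })
    where
    body : (S : Pred (FTrace k)) → F.⟦ ψ ⟧ (F.extend S σF) restrictsTo L.⟦ ψ ⟧ (L.extend (S ∘ inj₂) σL)
    body S = ⟦⟧-agreeOnStreams ψ (extend-agreeOnStreams σF≈σL S)
  ⟦⟧-agreeOnStreams (var i) σF≈σL f =
    mk⇔ (λ x → lift (to (σF≈σL i f) (lower x))) (λ x → lift (from (σF≈σL i f) (lower x)))

  emptyVal-agreeOnStreams : F.emptyVal agreeOnStreams L.emptyVal
  emptyVal-agreeOnStreams ()

mainTheorem12 : ∀ {k : ℕ} (ψ : Formula k 0) → Guarded ψ →
    ∀ (f : Stream k) → (⟦ ψ ⟧F (inj₂ f) → ⟦ ψ ⟧L f) × (⟦ ψ ⟧L f → ⟦ ψ ⟧F (inj₂ f))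
mainTheorem12 ψ _ f = to semantics-agree , from semantics-agree
  where
  semantics-agree : ⟦ ψ ⟧F (inj₂ f) ⇔ ⟦ ψ ⟧L f
  semantics-agree = ⟦⟧-agreeOnStreams ψ emptyVal-agreeOnStreams f
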